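{- For every infinite cardinal $\kappa$, the complete graph $K_\kappa$, the Turán graphs $T_{\kappa,k}$ for $2\le k<\omega$, and the Cantor graph are braided.
   Context: Let $H=\langle V,E^*\rangle$ be a graph. A set $L\subseteq V$ is a covering set if for every $v\in V\setminus L$ there is $a\in L$ with $\{v,a\}\in E^*$. $H$ is braided if for every $W\subseteq V$ with $|W|<|V|$ there is a finite covering set $L\subseteq V\setminus W$. The Turán graph $T_{\kappa,n}$ has vertex set $\kappa\times n$ and edges $\{\langle\alpha,i\rangle,\langle\beta,j\rangle\}$ for $\alpha,\beta\in\kappa$, $i\ne j<n$. The Cantor graph has as vertices all finite $0$-$1$ sequences, with $\{s,t\}$ an edge iff $s\subsetneq t$ or $t\subsetneq s$. -}

module Defs where

open import Data.Nat using (ℕ; _≤_)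
open import Data.Fin using (Fin)
open import Data.Bool using (Bool; true; false)
open import Data.List using (List; []; _++_)
open import Data.List.Membership.Propositional using (_∈_)
open import Data.List.Relation.Unary.All using (All)
open import Data.List.Relation.Unary.Any using (Any)
open import Data.Product using (Σ; ∃; _×_)
open import Data.Sum using (_⊎_)
open import Function.Bundles using (_↣_)
open import Relation.Nullary using (¬_)
open import Relation.Binary.PropositionalEquality using (_≡_; _≢_)

record Graph : Set₁ where
  field
    V   : Set
    Adj : V → V → Set
open Graph public

-- Subsets of V are given by characteristic functions (W v ≡ true means v ∈ W).
Subset : Set → Set
Subset V = V → Bool

Elems : {V : Set} → Subset V → Set
Elems {V} W = Σ V (λ v → W v ≡ true)

-- |W| < |V| for W ⊆ V: there is no injection from V into W
-- (an injection W ↪ V, the inclusion, always exists).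
SmallerThanV : {V : Set} → Subset V → Set
SmallerThanV {V} W = ¬ (V ↣ Elems W)

IsCovering : (H : Graph) → List (V H) → Set
IsCovering H L = ∀ v → ¬ (v ∈ L) → Any (λ a → Adj H v a) L

Braided : Graph → Set
Braided H = ∀ (W : Subset (V H)) → SmallerThanV W →
  ∃ λ (L : List (V H)) → All (λ a → W a ≡ false) L × IsCovering H L

Infinite : Set → Set
Infinite K = ℕ ↣ K

Complete : Set → Graph
Complete K = record { V = K ; Adj = λ α β → α ≢ β }

Turan : Set → ℕ → Graph
Turan K n = record
  { V = K × Fin n
  ; Adj = λ x y → Data.Product.proj₂ x ≢ Data.Product.proj₂ y }

StrictPrefix : List Bool → List Bool → Set
StrictPrefix s t = ∃ λ (u : List Bool) → (u ≢ []) × (s ++ u ≡ t)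

Cantor : Graph
Cantor = record
  { V = List Bool
  ; Adj = λ s t → StrictPrefix s t ⊎ StrictPrefix t s }

{-# OPTIONS --safe #-}
-- Under excluded middle, a set W with |W| < |V| misses some point of the image
-- of any injection V ↣ V.  For K_κ this gives one vertex outside W, for
-- T_{κ,k} one outside W in each of two colour classes, and these already
-- cover.  In the Cantor graph, the cone {s ++ t} of a node s outside W is
-- covered by s, and the cone of s is covered (by finitely many of its nodes
-- outside W) as soon as the cones of both children are.  So if the whole graph
-- had no such cover there would be an infinite branch of uncovered nodes, all
-- in W; it has a node of each length and the Cantor graph is countable, so V
-- injects into W.
module Submission where

open import Defs
open import Level using (0ℓ)
open import Axiom.ExcludedMiddle using (ExcludedMiddle)
open import Axiom.DoubleNegationElimination using (em⇒dne)
open import Data.Bool using (Bool; true; false)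
open import Data.Bool.Properties using (¬-not)
open import Data.Empty using (⊥-elim)
open import Data.Fin using (Fin) renaming (zero to fzero; suc to fsuc)
open import Data.Fin.Properties using (toℕ-injective)
open import Data.List using (List; []; _∷_; _++_; [_]; length)
open import Data.List.Properties using (++-assoc; ++-identityʳ; length-++)
open import Data.List.Membership.Propositional using (_∉_)
open import Data.List.Relation.Unary.All as All using (All; _∷_)
open import Data.List.Relation.Unary.All.Properties as AllP using ()
open import Data.List.Relation.Unary.Any using (Any; here; there)
open import Data.List.Relation.Unary.Any.Properties as AnyP using ()
open import Data.Nat using (ℕ; zero; suc; _≤_; s≤s; z≤n)
open import Data.Nat.Properties using (+-comm)
open import Data.Nat.Binary as ℕᵇ using (ℕᵇ; 2[1+_]; 1+[2_])
open import Data.Nat.Binary.Properties as ℕᵇP using ()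
open import Data.Product using (Σ; ∃; _×_; _,_; proj₁; proj₂)
open import Data.Product.Function.NonDependent.Propositional using (_×-↣_)
open import Data.Sum using (inj₁; inj₂)
open import Function using (_∘_)
open import Function.Bundles using (_↣_; mk↣; Injection)
open import Function.Construct.Composition using (_↣-∘_)
open import Function.Construct.Identity using (↣-id)
open import Relation.Nullary using (¬_; yes; no)
open import Relation.Binary.PropositionalEquality
  using (_≡_; refl; sym; trans; cong; subst)

open Injection using (to; injective)

module _ {V : Set} {W : Subset V} (small : SmallerThanV W) where

  image-not-⊆ : (f : V ↣ V) → ¬ (∀ v → W (to f v) ≡ true)
  image-not-⊆ f f⊆W = small (mk↣ {to = λ v → to f v , f⊆W v} (injective f ∘ cong proj₁))

  image-meets-complement : ExcludedMiddle 0ℓ → (f : V ↣ V) → ∃ λ v → W (to f v) ≡ false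
  image-meets-complement lem f = em⇒dne lem λ ∄ →
    image-not-⊆ f λ v → ¬-not λ Wfv≡false → ∄ (v , Wfv≡false)

complete-singleton-cover : {K : Set} (a : K) → IsCovering (Complete K) [ a ]
complete-singleton-cover a v v∉ = here (v∉ ∘ here)

complete-braided : ExcludedMiddle 0ℓ → (K : Set) → Braided (Complete K)
complete-braided lem K W small =
  let a , Wa≡false = image-meets-complement small lem (↣-id K)
  in [ a ] , Wa≡false ∷ All.[] , complete-singleton-cover a

Fin↣ℕ : (k : ℕ) → Fin k ↣ ℕ
Fin↣ℕ k = mk↣ toℕ-injective

absorbs-Fin : {K : Set} → Infinite K → (K × K) ↣ K → (k : ℕ) → (K × Fin k) ↣ K
absorbs-Fin inf pair k = pair ↣-∘ (↣-id _ ×-↣ (inf ↣-∘ Fin↣ℕ k))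

into-colour : {A K J : Set} → A ↣ K → J → A ↣ (K × J)
into-colour h j = mk↣ {to = λ a → to h a , j} (injective h ∘ cong proj₁)

turan-two-colours-cover : {K : Set} {k : ℕ} (α β : K) →
  IsCovering (Turan K (suc (suc k))) ((α , fzero) ∷ (β , fsuc fzero) ∷ [])
turan-two-colours-cover α β (γ , fzero)  _ = there (here λ ())
turan-two-colours-cover α β (γ , fsuc c) _ = here λ ()

turan-braided : ExcludedMiddle 0ℓ → (K : Set) → Infinite K → (K × K) ↣ K →
  (k : ℕ) → 2 ≤ k → Braided (Turan K k)
turan-braided lem K inf pair k@(suc (suc _)) (s≤s (s≤s z≤n)) W small =
  let h = absorbs-Fin inf pair k
      α , Wα≡false = image-meets-complement small lem (into-colour h fzero)
      β , Wβ≡false = image-meets-complement small lem (into-colour h (fsuc fzero))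
  in _ , Wα≡false ∷ Wβ≡false ∷ All.[] , turan-two-colours-cover (to h α) (to h β)

-- The bijective binary numerals ℕᵇ are exactly the 0-1 sequences.
toℕᵇ : List Bool → ℕᵇ
toℕᵇ []          = ℕᵇ.zero
toℕᵇ (true ∷ s)  = 2[1+ toℕᵇ s ]
toℕᵇ (false ∷ s) = 1+[2 toℕᵇ s ]

fromℕᵇ : ℕᵇ → List Bool
fromℕᵇ ℕᵇ.zero    = []
fromℕᵇ 2[1+ n ] = true ∷ fromℕᵇ n
fromℕᵇ 1+[2 n ] = false ∷ fromℕᵇ n

fromℕᵇ-toℕᵇ : ∀ s → fromℕᵇ (toℕᵇ s) ≡ s
fromℕᵇ-toℕᵇ []          = refl
fromℕᵇ-toℕᵇ (true ∷ s)  = cong (true ∷_) (fromℕᵇ-toℕᵇ s)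
fromℕᵇ-toℕᵇ (false ∷ s) = cong (false ∷_) (fromℕᵇ-toℕᵇ s)

toℕᵇ-injective : ∀ {s t} → toℕᵇ s ≡ toℕᵇ t → s ≡ t
toℕᵇ-injective {s} {t} eq =
  trans (sym (fromℕᵇ-toℕᵇ s)) (trans (cong fromℕᵇ eq) (fromℕᵇ-toℕᵇ t))

List-Bool↣ℕ : List Bool ↣ ℕ
List-Bool↣ℕ = mk↣ (toℕᵇ-injective ∘ ℕᵇP.toℕ-injective)

Extends : List Bool → List Bool → Set
Extends s a = ∃ λ u → s ++ u ≡ a

extends-child⇒extends : ∀ s b {a} → Extends (s ++ [ b ]) a → Extends s a
extends-child⇒extends s b (u , eq) = b ∷ u , trans (sym (++-assoc s [ b ] u)) eq

extends-child⇒strict : ∀ s b {a} → Extends (s ++ [ b ]) a → StrictPrefix s a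
extends-child⇒strict s b (u , eq) = b ∷ u , (λ ()) , trans (sym (++-assoc s [ b ] u)) eq

CoversCone : List Bool → List (List Bool) → Set
CoversCone s L = ∀ t → s ++ t ∉ L → Any (Adj Cantor (s ++ t)) L

covers-child-cone : ∀ s b {L} → CoversCone (s ++ [ b ]) L →
  ∀ t → s ++ b ∷ t ∉ L → Any (Adj Cantor (s ++ b ∷ t)) L
covers-child-cone s b {L} cov t = subst (λ v → v ∉ L → Any (Adj Cantor v) L)
  (++-assoc s [ b ] t) (cov t)

module Cones (W : Subset (List Bool)) where

  record ConeCover (s : List Bool) : Set where
    field
      first   : List Bool
      rest    : List (List Bool)
      outside : All (λ a → W a ≡ false) (first ∷ rest)
      above   : All (Extends s) (first ∷ rest)
      covers  : CoversCone s (first ∷ rest)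

    members : List (List Bool)
    members = first ∷ rest

  singleton-cover : ∀ s → W s ≡ false → ConeCover s
  singleton-cover s Ws≡false = record
    { first = s ; rest = [] ; outside = Ws≡false ∷ All.[]
    ; above = ([] , ++-identityʳ s) ∷ All.[] ; covers = covers }
    where
      covers : CoversCone s [ s ]
      covers []      s∉ = ⊥-elim (s∉ (here (++-identityʳ s)))
      covers (b ∷ t) _  = here (inj₂ (b ∷ t , (λ ()) , refl))

  merge-covers : ∀ s → ConeCover (s ++ [ false ]) → ConeCover (s ++ [ true ]) → ConeCover s
  merge-covers s c₀ c₁ = record
    { first = C₀.first ; rest = C₀.rest ++ C₁.members
    ; outside = AllP.++⁺ C₀.outside C₁.outside
    ; above = AllP.++⁺ (All.map (extends-child⇒extends s false) C₀.above)
                       (All.map (extends-child⇒extends s true) C₁.above)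
    ; covers = covers }
    where
      module C₀ = ConeCover c₀
      module C₁ = ConeCover c₁
      covers : CoversCone s (C₀.members ++ C₁.members)
      covers [] _ =
        subst (λ v → Any (Adj Cantor v) (C₀.members ++ C₁.members)) (sym (++-identityʳ s)) (here (inj₁ (extends-child⇒strict s false (All.head C₀.above))))
      covers (false ∷ t) ∉ = AnyP.++⁺ˡ
        (covers-child-cone s false C₀.covers t (∉ ∘ AnyP.++⁺ˡ))
      covers (true ∷ t) ∉ = AnyP.++⁺ʳ C₀.members
        (covers-child-cone s true C₁.covers t (∉ ∘ AnyP.++⁺ʳ C₀.members))

  uncovered⇒∈W : ∀ s → ¬ ConeCover s → W s ≡ true
  uncovered⇒∈W s ¬cover = ¬-not (¬cover ∘ singleton-cover s)

  uncovered-child : ExcludedMiddle 0ℓ → ∀ s → ¬ ConeCover s → ∃ λ b → ¬ ConeCover (s ++ [ b ])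
  uncovered-child lem s ¬cover with lem {ConeCover (s ++ [ false ])}
  ... | no ¬cover₀ = false , ¬cover₀
  ... | yes cover₀ = true , ¬cover ∘ merge-covers s cover₀

  module UncoveredBranch (lem : ExcludedMiddle 0ℓ) (root : ¬ ConeCover []) where

    Uncovered : Set
    Uncovered = Σ (List Bool) (¬_ ∘ ConeCover)

    descend : Uncovered → Uncovered
    descend (s , ¬cover) = let b , ¬coverᵇ = uncovered-child lem s ¬cover in s ++ [ b ] , ¬coverᵇ

    branch : ℕ → Uncovered
    branch zero    = [] , root
    branch (suc n) = descend (branch n)

    length-branch : ∀ n → length (proj₁ (branch n)) ≡ n
    length-branch zero    = refl
    length-branch (suc n) =
      trans (length-++ s) (trans (+-comm (length s) 1) (cong suc (length-branch n)))
      where s = proj₁ (branch n)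

    branch↣ : ℕ ↣ List Bool
    branch↣ = mk↣ {to = proj₁ ∘ branch} λ {m} {n} eq →
      trans (sym (length-branch m)) (trans (cong length eq) (length-branch n))

    branch⊆W : ∀ n → W (to branch↣ n) ≡ true
    branch⊆W n = uncovered⇒∈W _ (proj₂ (branch n))

cantor-braided : ExcludedMiddle 0ℓ → Braided Cantor
cantor-braided lem W small with lem {Cones.ConeCover W []}
... | yes cover = members , outside , covers
  where open Cones.ConeCover cover
... | no root = ⊥-elim (image-not-⊆ small (branch↣ ↣-∘ List-Bool↣ℕ) (branch⊆W ∘ to List-Bool↣ℕ))
  where open Cones.UncoveredBranch W lem root

proposition3p10 : ExcludedMiddle 0ℓ →
    ((K : Set) → Infinite K → (K × K) ↣ K →
      Braided (Complete K) × ((k : ℕ) → 2 ≤ k → Braided (Turan K k)))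
    × Braided Cantor
proposition3p10 lem =
  (λ K inf pair → complete-braided lem K , turan-braided lem K inf pair) , cantor-braided lem
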